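{- Let $n\geq k\geq 3$ be odd integers such that $\gcd(n,k-1)=1$. Then there exists a diagonal $\mathrm{M}^0_{\mathbb{Z}_k\oplus\mathbb{Z}_n}(n;k)$.
   Context: A partially filled array is an array in which some cells may be empty. Given a subset $\Omega$ of an abelian group $(\Gamma,+)$, a $\mathrm{M}^0_\Omega(n;k)$ is a partially filled $n\times n$ array with entries in $\Omega$ in which every element of $\Omega$ appears exactly once, each row and each column has exactly $k$ filled cells, and the entries of each row and of each column sum to $0\in\Gamma$. For a square $n\times n$ partially filled array $A=(a_{i,j})$, the cell $(i,j)$ belongs to the diagonal $D_r$ if $j-i\equiv r\pmod n$; $A$ is diagonal if its nonempty cells are exactly the cells of $k$ consecutive diagonals $D_r,D_{r+1},\ldots,D_{r+k-1}$ (indices mod $n$). $\mathbb{Z}_r$ denotes the cyclic group of order $r$. -}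

module Defs where

open import Data.Nat using (ℕ; zero; suc; _+_; _*_; _∸_; _%_; _<_; NonZero)
open import Data.Nat.DivMod using (_mod_)
open import Data.Fin using (Fin; toℕ)
open import Data.Maybe using (Maybe; just; nothing)
open import Data.Product using (_×_; _,_; Σ; ∃; ∃-syntax; proj₁; proj₂)
open import Data.Unit using (⊤)
open import Data.Empty using (⊥)
open import Data.List using (List; []; _∷_; foldr; map; allFin)
open import Relation.Binary.PropositionalEquality using (_≡_)
open import Function.Bundles using (_⇔_)

addMod : (m : ℕ) .{{_ : NonZero m}} → Fin m → Fin m → Fin m
addMod m a b = (toℕ a + toℕ b) mod m

zeroMod : (m : ℕ) .{{_ : NonZero m}} → Fin m
zeroMod m = 0 mod m

Γ : ℕ → ℕ → Set
Γ k n = Fin k × Fin n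

addΓ : (k n : ℕ) .{{_ : NonZero k}} .{{_ : NonZero n}} → Γ k n → Γ k n → Γ k n
addΓ k n (a , b) (c , d) = addMod k a c , addMod n b d

zeroΓ : (k n : ℕ) .{{_ : NonZero k}} .{{_ : NonZero n}} → Γ k n
zeroΓ k n = zeroMod k , zeroMod n

-- A partially filled n × n array with entries in A (nothing = empty cell).
PArray : ℕ → Set → Set
PArray n A = Fin n → Fin n → Maybe A

rowCells : ∀ {n} {A : Set} → PArray n A → Fin n → List (Maybe A)
rowCells {n} M i = map (λ j → M i j) (allFin n)

colCells : ∀ {n} {A : Set} → PArray n A → Fin n → List (Maybe A)
colCells {n} M j = map (λ i → M i j) (allFin n)

countFilled : ∀ {A : Set} → List (Maybe A) → ℕ
countFilled []             = 0
countFilled (nothing ∷ xs) = countFilled xs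
countFilled (just _ ∷ xs)  = suc (countFilled xs)

sumFilled : ∀ {A : Set} → (A → A → A) → A → List (Maybe A) → A
sumFilled _∙_ e []             = e
sumFilled _∙_ e (nothing ∷ xs) = sumFilled _∙_ e xs
sumFilled _∙_ e (just x ∷ xs)  = x ∙ sumFilled _∙_ e xs

-- A M^0_Ω(n;k) with Ω = Γ = Z_k ⊕ Z_n (the whole group):
--  * every element of Ω appears exactly once,
--  * every row and every column has exactly k filled cells,
--  * the entries of every row and of every column sum to 0.
record IsM0 (k n : ℕ) .{{_ : NonZero k}} .{{_ : NonZero n}}
            (M : PArray n (Γ k n)) : Set where
  field
    appearsOnce : ∀ (g : Γ k n) →
      Σ (Fin n × Fin n) λ c →
        (M (proj₁ c) (proj₂ c) ≡ just g) ×
        (∀ i j → M i j ≡ just g → (i , j) ≡ c)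
    rowCount : ∀ i → countFilled (rowCells M i) ≡ k
    colCount : ∀ j → countFilled (colCells M j) ≡ k
    rowSum   : ∀ i → sumFilled (addΓ k n) (zeroΓ k n) (rowCells M i) ≡ zeroΓ k n
    colSum   : ∀ j → sumFilled (addΓ k n) (zeroΓ k n) (colCells M j) ≡ zeroΓ k n

-- Cell (i,j) lies on diagonal D_d, d = (j - i) mod n, i.e. d ≡ j + (n - i) mod n.
diagIndex : (n : ℕ) .{{_ : NonZero n}} → Fin n → Fin n → Fin n
diagIndex n i j = (toℕ j + (n ∸ toℕ i)) mod n

InDiagRange : (n k : ℕ) .{{_ : NonZero n}} → Fin n → Fin n → Set
InDiagRange n k r d = ∃[ t ] (t < k × d ≡ (toℕ r + t) mod n)

IsFilled : ∀ {A : Set} → Maybe A → Set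
IsFilled (just _) = ⊤
IsFilled nothing  = ⊥

IsDiagonal : (n k : ℕ) .{{_ : NonZero n}} {A : Set} → PArray n A → Set
IsDiagonal n k M = ∃[ r ] (∀ i j → IsFilled (M i j) ⇔ InDiagRange n k r (diagIndex n i j))

-- Put the entry (d, x_d · i) in the cell of row i on diagonal d (i.e. j - i ≡ d), for d < k,
-- where x_d = 1 except x_s = n - k + 1 ≡ 1 - k (mod n), s = (k - 1) / 2.  Each diagonal meets
-- every row and every column once, so a row collects Σ_d (d, x_d · i) and a column
-- Σ_d (d, x_d · (j - d)).  The first coordinates give Σ_{d<k} d = s k ≡ 0 (mod k); the second ones
-- vanish because Σ x_d = n and Σ x_d · d = s n.  Since gcd(n, k - 1) = 1 every x_d is invertible
-- modulo n, so on diagonal d the value x_d · i determines the row i: every element of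
-- Z_k ⊕ Z_n occurs exactly once.
module Submission where

open import Defs
open import Data.Nat using (ℕ; _≤_; _∸_; _%_; NonZero)
open import Data.Nat.GCD using (gcd)
open import Data.Product using (_×_; Σ; ∃-syntax)
open import Relation.Binary.PropositionalEquality using (_≡_)

open import Data.Bool using (true; false; if_then_else_)
open import Data.Fin using (Fin; toℕ; fromℕ<; inject≤; opposite)
open import Data.Fin.Permutation using (Permutation′; permutation; _⟨$⟩ʳ_; _⟨$⟩ˡ_; inverseˡ; reverse)
open import Data.Fin.Properties using (toℕ-injective; toℕ-fromℕ<; toℕ<n; opposite-prop; toℕ-inject≤)
open import Data.List using (map; allFin; tabulate)
open import Data.List.Properties using (map-tabulate)
open import Data.Maybe using (Maybe; just; nothing; maybe′)
open import Data.Nat using (zero; suc; _+_; _*_; _<_; _<?_; _≡ᵇ_; s≤s; z≤n; s<s; s≤s⁻¹)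
open import Data.Nat.Coprimality using (Coprime; coprime-Bézout; gcd≡1⇒coprime)
open import Data.Nat.DivMod using (_mod_; _/_; m≡m%n+[m/n]*n; [m+n]%n≡m%n; [m+kn]%n≡m%n; m*n%n≡0;
  m%n%n≡m%n; %-distribˡ-+; %-distribˡ-*; m<n⇒m%n≡m)
open import Data.Nat.GCD using (module Bézout)
open import Data.Nat.Properties
open import Data.Nat.Solver using (module +-*-Solver)
open import Data.Product using (_,_; proj₁; proj₂)
open import Data.Unit using (tt)
open import Function using (_∘_)
open import Function.Bundles using (_⇔_; mk⇔)
open import Function.Properties.Equivalence using () renaming (trans to ⇔-trans)
open import Relation.Binary.PropositionalEquality using (refl; sym; trans; cong; cong₂; subst; module ≡-Reasoning)
open import Relation.Nullary using (yes; no; contradiction)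
open import Algebra.Properties.CommutativeMonoid.Sum +-0-commutativeMonoid
  using (sum-syntax; sum-cong-≗; ∑-distrib-+; ∑-permute)
open import Algebra.Properties.CommutativeSemigroup +-commutativeSemigroup
  using (x∙yz≈y∙xz; xy∙z≈y∙xz; xy∙z≈xz∙y)
open import Algebra.Properties.CommutativeSemigroup *-commutativeSemigroup
  using () renaming (xy∙z≈y∙xz to *-xy∙z≈y∙xz)
open ≡-Reasoning

module _ {n : ℕ} .{{_ : NonZero n}} where

  [m%n+o]%n≡[m+o]%n : ∀ m o → (m % n + o) % n ≡ (m + o) % n
  [m%n+o]%n≡[m+o]%n m o = begin
    (m % n + o) % n           ≡⟨ %-distribˡ-+ (m % n) o n ⟩
    (m % n % n + o % n) % n   ≡⟨ cong (λ z → (z + o % n) % n) (m%n%n≡m%n m n) ⟩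
    (m % n + o % n) % n       ≡⟨ %-distribˡ-+ m o n ⟨
    (m + o) % n               ∎

  [m+o%n]%n≡[m+o]%n : ∀ m o → (m + o % n) % n ≡ (m + o) % n
  [m+o%n]%n≡[m+o]%n m o = begin
    (m + o % n) % n  ≡⟨ cong (_% n) (+-comm m (o % n)) ⟩
    (o % n + m) % n  ≡⟨ [m%n+o]%n≡[m+o]%n o m ⟩
    (o + m) % n      ≡⟨ cong (_% n) (+-comm o m) ⟩
    (m + o) % n      ∎

  [m%n*o]%n≡[m*o]%n : ∀ m o → (m % n * o) % n ≡ (m * o) % n
  [m%n*o]%n≡[m*o]%n m o = begin
    (m % n * o) % n           ≡⟨ %-distribˡ-* (m % n) o n ⟩
    (m % n % n * (o % n)) % n ≡⟨ cong (λ z → (z * (o % n)) % n) (m%n%n≡m%n m n) ⟩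
    (m % n * (o % n)) % n     ≡⟨ %-distribˡ-* m o n ⟨
    (m * o) % n               ∎

  [m*o%n]%n≡[m*o]%n : ∀ m o → (m * (o % n)) % n ≡ (m * o) % n
  [m*o%n]%n≡[m*o]%n m o = begin
    (m * (o % n)) % n  ≡⟨ cong (_% n) (*-comm m (o % n)) ⟩
    (o % n * m) % n    ≡⟨ [m%n*o]%n≡[m*o]%n o m ⟩
    (o * m) % n        ≡⟨ cong (_% n) (*-comm o m) ⟩
    (m * o) % n        ∎

  m+pn≡o+qn⇒m%n≡o%n : ∀ m p o q → m + p * n ≡ o + q * n → m % n ≡ o % n
  m+pn≡o+qn⇒m%n≡o%n m p o q eq = begin
    m % n            ≡⟨ [m+kn]%n≡m%n m p n ⟨
    (m + p * n) % n  ≡⟨ cong (_% n) eq ⟩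
    (o + q * n) % n  ≡⟨ [m+kn]%n≡m%n o q n ⟩
    o % n            ∎

  toℕ-mod : ∀ m → toℕ (m mod n) ≡ m % n
  toℕ-mod m = toℕ-fromℕ< _

  mod-cong : ∀ {m o} → m % n ≡ o % n → m mod n ≡ o mod n
  mod-cong {m} {o} eq = toℕ-injective (trans (toℕ-mod m) (trans eq (sym (toℕ-mod o))))

  toℕ%n : ∀ (i : Fin n) → toℕ i % n ≡ toℕ i
  toℕ%n i = m<n⇒m%n≡m (toℕ<n i)

  mod≡zeroMod : ∀ {m} → m % n ≡ 0 → m mod n ≡ zeroMod n
  mod≡zeroMod eq = mod-cong (trans eq (sym (m*n%n≡0 0 n)))

  ∑-% : ∀ {m} (f : Fin m → ℕ) → (∑[ a < m ] (f a % n)) % n ≡ (∑[ a < m ] f a) % n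
  ∑-% {zero}  f = refl
  ∑-% {suc m} f = begin
    (f₀ % n + ∑[ a < m ] (f (Fin.suc a) % n)) % n        ≡⟨ [m%n+o]%n≡[m+o]%n f₀ _ ⟩
    (f₀ + ∑[ a < m ] (f (Fin.suc a) % n)) % n            ≡⟨ [m+o%n]%n≡[m+o]%n f₀ _ ⟨
    (f₀ + (∑[ a < m ] (f (Fin.suc a) % n)) % n) % n      ≡⟨ cong (λ z → (f₀ + z) % n) (∑-% (f ∘ Fin.suc)) ⟩
    (f₀ + (∑[ a < m ] f (Fin.suc a)) % n) % n            ≡⟨ [m+o%n]%n≡[m+o]%n f₀ _ ⟩
    (f₀ + ∑[ a < m ] f (Fin.suc a)) % n                  ∎
    where f₀ = f Fin.zero

  inverse-cancel : ∀ {x u} → (x * u) % n ≡ 1 % n → ∀ b → (x * ((u * b) % n)) % n ≡ b % n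
  inverse-cancel {x} {u} xu≡1 b = begin
    (x * ((u * b) % n)) % n  ≡⟨ [m*o%n]%n≡[m*o]%n x (u * b) ⟩
    (x * (u * b)) % n        ≡⟨ cong (_% n) (*-assoc x u b) ⟨
    (x * u * b) % n          ≡⟨ [m%n*o]%n≡[m*o]%n (x * u) b ⟨
    ((x * u) % n * b) % n    ≡⟨ cong (λ z → (z * b) % n) xu≡1 ⟩
    (1 % n * b) % n          ≡⟨ [m%n*o]%n≡[m*o]%n 1 b ⟩
    (1 * b) % n              ≡⟨ cong (_% n) (*-identityˡ b) ⟩
    b % n                    ∎

  inverse-solve : ∀ {x u} → (x * u) % n ≡ 1 % n → ∀ {i b} → (x * i) % n ≡ b % n → i % n ≡ (u * b) % n
  inverse-solve {x} {u} xu≡1 {i} {b} xi≡b = begin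
    i % n                    ≡⟨ cong (_% n) (*-identityˡ i) ⟨
    (1 * i) % n              ≡⟨ [m%n*o]%n≡[m*o]%n 1 i ⟨
    (1 % n * i) % n          ≡⟨ cong (λ z → (z * i) % n) xu≡1 ⟨
    ((x * u) % n * i) % n    ≡⟨ [m%n*o]%n≡[m*o]%n (x * u) i ⟩
    (x * u * i) % n          ≡⟨ cong (_% n) (*-xy∙z≈y∙xz x u i) ⟩
    (u * (x * i)) % n        ≡⟨ [m*o%n]%n≡[m*o]%n u (x * i) ⟨
    (u * ((x * i) % n)) % n  ≡⟨ cong (λ z → (u * z) % n) xi≡b ⟩
    (u * (b % n)) % n        ≡⟨ [m*o%n]%n≡[m*o]%n u b ⟩
    (u * b) % n              ∎

  toℕ-zeroMod+ : ∀ t → toℕ ((toℕ (zeroMod n) + t) mod n) ≡ t % n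
  toℕ-zeroMod+ t = trans (toℕ-mod _) (trans (cong (λ z → (z + t) % n) (toℕ-mod 0)) ([m%n+o]%n≡[m+o]%n 0 t))

  <⇔InDiagRange-zero : ∀ {k} → k ≤ n → ∀ d → toℕ d < k ⇔ InDiagRange n k (zeroMod n) d
  <⇔InDiagRange-zero {k} k≤n d = mk⇔
    (λ d<k → toℕ d , d<k , toℕ-injective (sym (trans (toℕ-zeroMod+ (toℕ d)) (toℕ%n d))))
    (λ { (t , t<k , d≡t) → subst (_< k) (sym (trans (cong toℕ d≡t)
                              (trans (toℕ-zeroMod+ t) (m<n⇒m%n≡m (<-≤-trans t<k k≤n))))) t<k })

  private
    i+[n∸i]≡n : ∀ (i : Fin n) → toℕ i + (n ∸ toℕ i) ≡ n
    i+[n∸i]≡n i = m+[n∸m]≡n (<⇒≤ (toℕ<n i))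

  diagIndex-addMod : ∀ i d → diagIndex n i (addMod n i d) ≡ d
  diagIndex-addMod i d = toℕ-injective (begin
    toℕ (diagIndex n i (addMod n i d))       ≡⟨ toℕ-mod _ ⟩
    (toℕ (addMod n i d) + (n ∸ toℕ i)) % n   ≡⟨ cong (λ z → (z + (n ∸ toℕ i)) % n) (toℕ-mod _) ⟩
    ((toℕ i + toℕ d) % n + (n ∸ toℕ i)) % n  ≡⟨ [m%n+o]%n≡[m+o]%n (toℕ i + toℕ d) _ ⟩
    (toℕ i + toℕ d + (n ∸ toℕ i)) % n        ≡⟨ cong (_% n) (xy∙z≈y∙xz (toℕ i) (toℕ d) _) ⟩
    (toℕ d + (toℕ i + (n ∸ toℕ i))) % n      ≡⟨ cong (λ z → (toℕ d + z) % n) (i+[n∸i]≡n i) ⟩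
    (toℕ d + n) % n                          ≡⟨ [m+n]%n≡m%n (toℕ d) n ⟩
    toℕ d % n                                ≡⟨ toℕ%n d ⟩
    toℕ d                                    ∎)

  addMod-diagIndex : ∀ i j → addMod n i (diagIndex n i j) ≡ j
  addMod-diagIndex i j = toℕ-injective (begin
    toℕ (addMod n i (diagIndex n i j))           ≡⟨ toℕ-mod _ ⟩
    (toℕ i + toℕ (diagIndex n i j)) % n          ≡⟨ cong (λ z → (toℕ i + z) % n) (toℕ-mod _) ⟩
    (toℕ i + (toℕ j + (n ∸ toℕ i)) % n) % n      ≡⟨ [m+o%n]%n≡[m+o]%n (toℕ i) _ ⟩
    (toℕ i + (toℕ j + (n ∸ toℕ i))) % n          ≡⟨ cong (_% n) (x∙yz≈y∙xz (toℕ i) (toℕ j) _) ⟩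
    (toℕ j + (toℕ i + (n ∸ toℕ i))) % n          ≡⟨ cong (λ z → (toℕ j + z) % n) (i+[n∸i]≡n i) ⟩
    (toℕ j + n) % n                              ≡⟨ [m+n]%n≡m%n (toℕ j) n ⟩
    toℕ j % n                                    ≡⟨ toℕ%n j ⟩
    toℕ j                                        ∎)

  addMod-comm : ∀ a b → addMod n a b ≡ addMod n b a
  addMod-comm a b = cong (_mod n) (+-comm (toℕ a) (toℕ b))

  addMod-cancelˡ : ∀ a {d e} → addMod n a d ≡ addMod n a e → d ≡ e
  addMod-cancelˡ a {d} {e} eq = begin
    d                           ≡⟨ diagIndex-addMod a d ⟨
    diagIndex n a (addMod n a d) ≡⟨ cong (diagIndex n a) eq ⟩
    diagIndex n a (addMod n a e) ≡⟨ diagIndex-addMod a e ⟩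
    e                           ∎

  diagIndex-involutive : ∀ j d → diagIndex n (diagIndex n d j) j ≡ d
  diagIndex-involutive j d = sym (addMod-cancelˡ e (begin
    addMod n e d                ≡⟨ addMod-comm e d ⟩
    addMod n d e                ≡⟨ addMod-diagIndex d j ⟩
    j                           ≡⟨ addMod-diagIndex e j ⟨
    addMod n e (diagIndex n e j) ∎))
    where e = diagIndex n d j

  rowShift : Fin n → Permutation′ n
  rowShift i = permutation (diagIndex n i) (addMod n i) (diagIndex-addMod i) (addMod-diagIndex i)

  colShift : Fin n → Permutation′ n
  colShift j = permutation (λ i → diagIndex n i j) (λ d → diagIndex n d j)
                 (diagIndex-involutive j) (diagIndex-involutive j)

∑-const : ∀ k c → ∑[ d < k ] c ≡ k * c
∑-const zero    c = refl
∑-const (suc k) c = cong (c +_) (∑-const k c)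

∑-reindex : ∀ {n} (π : Permutation′ n) (F : Fin n → Fin n → ℕ) →
            ∑[ i < n ] F i (π ⟨$⟩ʳ i) ≡ ∑[ d < n ] F (π ⟨$⟩ˡ d) d
∑-reindex {n} π F = begin
  ∑[ i < n ] F i (π ⟨$⟩ʳ i)                    ≡⟨ sum-cong-≗ (λ i → cong (λ r → F r (π ⟨$⟩ʳ i)) (inverseˡ π)) ⟨
  ∑[ i < n ] F (π ⟨$⟩ˡ (π ⟨$⟩ʳ i)) (π ⟨$⟩ʳ i)  ≡⟨ ∑-permute (λ d → F (π ⟨$⟩ˡ d) d) π ⟨
  ∑[ d < n ] F (π ⟨$⟩ˡ d) d                    ∎

∑-restrict : ∀ {k n} (k≤n : k ≤ n) (f : Fin n → ℕ) → (∀ d → k ≤ toℕ d → f d ≡ 0) →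
             ∑[ d < n ] f d ≡ ∑[ d < k ] f (inject≤ d k≤n)
∑-restrict {zero}  {n}     _   f vanish = begin
  ∑[ d < n ] f d  ≡⟨ sum-cong-≗ (λ d → vanish d z≤n) ⟩
  ∑[ d < n ] 0    ≡⟨ ∑-const n 0 ⟩
  n * 0           ≡⟨ *-zeroʳ n ⟩
  0               ∎
∑-restrict {suc k} {suc n} k≤n f vanish =
  cong (f Fin.zero +_) (∑-restrict (s≤s⁻¹ k≤n) (f ∘ Fin.suc) (λ d k≤d → vanish (Fin.suc d) (s≤s k≤d)))

∑-toℕ-twice : ∀ m → ∑[ d < suc m ] toℕ d + ∑[ d < suc m ] toℕ d ≡ suc m * m
∑-toℕ-twice m = begin
  ∑[ d < suc m ] toℕ d + ∑[ d < suc m ] toℕ d            ≡⟨ cong (∑[ d < suc m ] toℕ d +_) (∑-permute toℕ (reverse {suc m})) ⟩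
  ∑[ d < suc m ] toℕ d + ∑[ d < suc m ] toℕ (opposite d) ≡⟨ ∑-distrib-+ {suc m} toℕ (toℕ ∘ opposite) ⟨
  ∑[ d < suc m ] (toℕ d + toℕ (opposite d))             ≡⟨ sum-cong-≗ d+opposite-d≡m ⟩
  ∑[ d < suc m ] m                                      ≡⟨ ∑-const (suc m) m ⟩
  suc m * m                                            ∎
  where
  d+opposite-d≡m : ∀ d → toℕ d + toℕ (opposite d) ≡ m
  d+opposite-d≡m d = trans (cong (toℕ d +_) (opposite-prop d)) (m+[n∸m]≡n (s≤s⁻¹ (toℕ<n d)))

∑-toℕ-odd : ∀ s → ∑[ d < suc (s + s) ] toℕ d ≡ s * suc (s + s)
∑-toℕ-odd s = *-cancelˡ-≡ _ _ 2 (begin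
  2 * S                    ≡⟨ cong (S +_) (+-identityʳ S) ⟩
  S + S                    ≡⟨ ∑-toℕ-twice (s + s) ⟩
  suc (s + s) * (s + s)    ≡⟨ lemma s ⟩
  2 * (s * suc (s + s))    ∎)
  where
  S = ∑[ d < suc (s + s) ] toℕ d
  open +-*-Solver
  lemma : ∀ s → suc (s + s) * (s + s) ≡ 2 * (s * suc (s + s))
  lemma = solve 1 (λ s → (con 1 :+ (s :+ s)) :* (s :+ s) := con 2 :* (s :* (con 1 :+ (s :+ s)))) refl

bump : ℕ → ℕ → ℕ → ℕ
bump s c d = if d ≡ᵇ s then suc c else 1

∑-bump : ∀ {k} s c (h : ℕ → ℕ) → s < k →
         ∑[ d < k ] (bump s c (toℕ d) * h (toℕ d)) ≡ ∑[ d < k ] h (toℕ d) + c * h s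
∑-bump {suc k} zero    c h _ = begin
  suc c * h 0 + ∑[ d < k ] (1 * h (suc (toℕ d)))  ≡⟨ cong (suc c * h 0 +_) (sum-cong-≗ {k} (λ d → *-identityˡ (h (suc (toℕ d))))) ⟩
  h 0 + c * h 0 + ∑[ d < k ] h (suc (toℕ d))      ≡⟨ xy∙z≈xz∙y (h 0) (c * h 0) _ ⟩
  h 0 + ∑[ d < k ] h (suc (toℕ d)) + c * h 0      ∎
∑-bump {suc k} (suc s) c h (s<s s<k) = begin
  1 * h 0 + ∑[ d < k ] (bump s c (toℕ d) * h (suc (toℕ d)))  ≡⟨ cong₂ _+_ (*-identityˡ (h 0)) (∑-bump s c (h ∘ suc) s<k) ⟩
  h 0 + (∑[ d < k ] h (suc (toℕ d)) + c * h (suc s))         ≡⟨ +-assoc (h 0) _ _ ⟨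
  h 0 + ∑[ d < k ] h (suc (toℕ d)) + c * h (suc s)           ∎

-- Bézout's identity gives either c * y ≡ -1 or c * y ≡ 1 modulo n; since e ≡ -c, the inverse
-- of e is y in the first case and y * (n - 1) in the second.
complement-invertible : ∀ {n c e} .{{_ : NonZero n}} → Coprime n c → e + c ≡ n →
                        ∃[ u ] (e * u) % n ≡ 1 % n
complement-invertible {n@(suc N)} {c} {e} coprime e+c≡n with coprime-Bézout coprime
... | Bézout.+- x y eq = y , m+pn≡o+qn⇒m%n≡o%n (e * y) x 1 y (begin
  e * y + x * n        ≡⟨ cong (e * y +_) eq ⟨
  e * y + (1 + y * c)  ≡⟨ lemma e y c ⟩
  1 + y * (e + c)      ≡⟨ cong (λ z → 1 + y * z) e+c≡n ⟩
  1 + y * n            ∎)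
  where
  open +-*-Solver
  lemma : ∀ e y c → e * y + (1 + y * c) ≡ 1 + y * (e + c)
  lemma = solve 3 (λ e y c → e :* y :+ (con 1 :+ y :* c) := con 1 :+ y :* (e :+ c)) refl
... | Bézout.-+ x y eq = y * N , m+pn≡o+qn⇒m%n≡o%n (e * (y * N)) (1 + x * N) 1 (y * N) (begin
  e * (y * N) + (1 + x * N) * n      ≡⟨ lemma₁ e y x N ⟩
  1 + (e * (y * N) + (1 + x * n) * N) ≡⟨ cong (λ z → 1 + (e * (y * N) + z * N)) eq ⟩
  1 + (e * (y * N) + y * c * N)       ≡⟨ cong suc (lemma₂ e y c N) ⟩
  1 + y * N * (e + c)                 ≡⟨ cong (λ z → 1 + y * N * z) e+c≡n ⟩
  1 + y * N * n                       ∎)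
  where
  open +-*-Solver
  lemma₁ : ∀ e y x N → e * (y * N) + (1 + x * N) * suc N ≡ 1 + (e * (y * N) + (1 + x * suc N) * N)
  lemma₁ = solve 4 (λ e y x N → e :* (y :* N) :+ (con 1 :+ x :* N) :* (con 1 :+ N)
                               := con 1 :+ (e :* (y :* N) :+ (con 1 :+ x :* (con 1 :+ N)) :* N)) refl
  lemma₂ : ∀ e y c N → e * (y * N) + y * c * N ≡ y * N * (e + c)
  lemma₂ = solve 4 (λ e y c N → e :* (y :* N) :+ y :* c :* N := y :* N :* (e :+ c)) refl

countFilled-tabulate : ∀ {A : Set} {m} (h : Fin m → Maybe A) →
                       countFilled (tabulate h) ≡ ∑[ j < m ] maybe′ (λ _ → 1) 0 (h j)
countFilled-tabulate {m = zero}  h = refl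
countFilled-tabulate {m = suc m} h with h Fin.zero
... | just _  = cong suc (countFilled-tabulate (h ∘ Fin.suc))
... | nothing = countFilled-tabulate (h ∘ Fin.suc)

countFilled-cells : ∀ {A : Set} {m} (h : Fin m → Maybe A) →
                    countFilled (map h (allFin m)) ≡ ∑[ j < m ] maybe′ (λ _ → 1) 0 (h j)
countFilled-cells h = trans (cong countFilled (map-tabulate (λ j → j) h)) (countFilled-tabulate h)

addMod-mod : ∀ m .{{_ : NonZero m}} a s → addMod m a (s mod m) ≡ (toℕ a + s) mod m
addMod-mod m a s = mod-cong (trans (cong (λ z → (toℕ a + z) % m) (toℕ-mod s)) ([m+o%n]%n≡[m+o]%n (toℕ a) s))

module _ (k n : ℕ) .{{_ : NonZero k}} .{{_ : NonZero n}} where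

  sumFilledΓ-tabulate : ∀ {m} (h : Fin m → Maybe (Γ k n)) →
    sumFilled (addΓ k n) (zeroΓ k n) (tabulate h) ≡
      ((∑[ j < m ] maybe′ (toℕ ∘ proj₁) 0 (h j)) mod k , (∑[ j < m ] maybe′ (toℕ ∘ proj₂) 0 (h j)) mod n)
  sumFilledΓ-tabulate {zero}  h = refl
  sumFilledΓ-tabulate {suc m} h with h Fin.zero
  ... | nothing      = sumFilledΓ-tabulate (h ∘ Fin.suc)
  ... | just (a , b) = begin
    addΓ k n (a , b) (sumFilled (addΓ k n) (zeroΓ k n) (tabulate (h ∘ Fin.suc)))
      ≡⟨ cong (addΓ k n (a , b)) (sumFilledΓ-tabulate (h ∘ Fin.suc)) ⟩
    addΓ k n (a , b) (_ mod k , _ mod n)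
      ≡⟨ cong₂ _,_ (addMod-mod k a _) (addMod-mod n b _) ⟩
    (_ mod k , _ mod n) ∎

  sumFilledΓ-cells : ∀ {m} (h : Fin m → Maybe (Γ k n)) →
    sumFilled (addΓ k n) (zeroΓ k n) (map h (allFin m)) ≡
      ((∑[ j < m ] maybe′ (toℕ ∘ proj₁) 0 (h j)) mod k , (∑[ j < m ] maybe′ (toℕ ∘ proj₂) 0 (h j)) mod n)
  sumFilledΓ-cells h = trans (cong (sumFilled (addΓ k n) (zeroΓ k n)) (map-tabulate (λ j → j) h)) (sumFilledΓ-tabulate h)

module DiagonalArray (n k s : ℕ) .{{_ : NonZero n}} .{{_ : NonZero k}}
                     (k≡1+2s : k ≡ suc (s + s)) (k≤n : k ≤ n) (coprime : Coprime n (k ∸ 1)) where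

  multiplier : ℕ → ℕ
  multiplier = bump s (n ∸ k)

  entry : Fin n → Fin n → Maybe (Γ k n)
  entry i d with toℕ d <? k
  ... | yes d<k = just (fromℕ< d<k , (multiplier (toℕ d) * toℕ i) mod n)
  ... | no _    = nothing

  array : PArray n (Γ k n)
  array i j = entry i (diagIndex n i j)

  entry-inject≤ : ∀ i (a : Fin k) → entry i (inject≤ a k≤n) ≡ just (a , (multiplier (toℕ a) * toℕ i) mod n)
  entry-inject≤ i a with toℕ (inject≤ a k≤n) <? k
  ... | yes d<k = cong just (cong₂ _,_ (toℕ-injective (trans (toℕ-fromℕ< d<k) (toℕ-inject≤ a k≤n)))
                                      (cong (λ d → (multiplier d * toℕ i) mod n) (toℕ-inject≤ a k≤n)))
  ... | no d≮k  = contradiction (subst (_< k) (sym (toℕ-inject≤ a k≤n)) (toℕ<n a)) d≮k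

  entry-vanishes : ∀ i d → k ≤ toℕ d → entry i d ≡ nothing
  entry-vanishes i d k≤d with toℕ d <? k
  ... | yes d<k = contradiction k≤d (<⇒≱ d<k)
  ... | no _    = refl

  entry-just : ∀ i d {a b} → entry i d ≡ just (a , b) →
               toℕ d ≡ toℕ a × (multiplier (toℕ d) * toℕ i) mod n ≡ b
  entry-just i d eq with toℕ d <? k
  entry-just i d refl | yes d<k = sym (toℕ-fromℕ< d<k) , refl
  entry-just i d ()   | no _

  entry-filled : ∀ i d → IsFilled (entry i d) ⇔ toℕ d < k
  entry-filled i d with toℕ d <? k
  ... | yes d<k = mk⇔ (λ _ → d<k) (λ _ → tt)
  ... | no d≮k  = mk⇔ (λ ()) d≮k

  ∑-entries : (w : Maybe (Γ k n) → ℕ) → w nothing ≡ 0 → (row : Fin n → Fin n) →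
              ∑[ d < n ] w (entry (row d) d) ≡
              ∑[ a < k ] w (just (a , (multiplier (toℕ a) * toℕ (row (inject≤ a k≤n))) mod n))
  ∑-entries w w₀ row = begin
    ∑[ d < n ] w (entry (row d) d)
      ≡⟨ ∑-restrict k≤n _ (λ d k≤d → trans (cong w (entry-vanishes (row d) d k≤d)) w₀) ⟩
    ∑[ a < k ] w (entry (row (inject≤ a k≤n)) (inject≤ a k≤n))
      ≡⟨ sum-cong-≗ (λ a → cong w (entry-inject≤ (row (inject≤ a k≤n)) a)) ⟩
    ∑[ a < k ] w (just (a , (multiplier (toℕ a) * toℕ (row (inject≤ a k≤n))) mod n)) ∎

  ∑-row : (w : Maybe (Γ k n) → ℕ) → w nothing ≡ 0 → ∀ i →
          ∑[ j < n ] w (array i j) ≡ ∑[ a < k ] w (just (a , (multiplier (toℕ a) * toℕ i) mod n))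
  ∑-row w w₀ i = trans (∑-reindex (rowShift i) (λ _ d → w (entry i d))) (∑-entries w w₀ (λ _ → i))

  ∑-col : (w : Maybe (Γ k n) → ℕ) → w nothing ≡ 0 → ∀ j →
          ∑[ i < n ] w (array i j) ≡
          ∑[ a < k ] w (just (a , (multiplier (toℕ a) * toℕ (diagIndex n (inject≤ a k≤n) j)) mod n))
  ∑-col w w₀ j = trans (∑-reindex (colShift j) (λ i d → w (entry i d))) (∑-entries w w₀ (λ d → diagIndex n d j))

  s<k : s < k
  s<k = subst (s <_) (sym k≡1+2s) (s≤s (m≤m+n s s))

  ∑-multiplier-const : ∀ v → ∑[ a < k ] (multiplier (toℕ a) * v) ≡ n * v
  ∑-multiplier-const v = begin
    ∑[ a < k ] (multiplier (toℕ a) * v)  ≡⟨ ∑-bump s (n ∸ k) (λ _ → v) s<k ⟩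
    ∑[ a < k ] v + (n ∸ k) * v           ≡⟨ cong (_+ (n ∸ k) * v) (∑-const k v) ⟩
    k * v + (n ∸ k) * v                  ≡⟨ *-distribʳ-+ v k (n ∸ k) ⟨
    (k + (n ∸ k)) * v                    ≡⟨ cong (_* v) (m+[n∸m]≡n k≤n) ⟩
    n * v                                ∎

  ∑-toℕ-k : ∑[ a < k ] toℕ a ≡ s * k
  ∑-toℕ-k = subst (λ m → ∑[ a < m ] toℕ a ≡ s * m) (sym k≡1+2s) (∑-toℕ-odd s)

  ∑-multiplier-toℕ : ∑[ a < k ] (multiplier (toℕ a) * toℕ a) ≡ s * n
  ∑-multiplier-toℕ = begin
    ∑[ a < k ] (multiplier (toℕ a) * toℕ a)  ≡⟨ ∑-bump s (n ∸ k) (λ a → a) s<k ⟩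
    ∑[ a < k ] toℕ a + (n ∸ k) * s           ≡⟨ cong₂ _+_ ∑-toℕ-k (*-comm (n ∸ k) s) ⟩
    s * k + s * (n ∸ k)                      ≡⟨ *-distribˡ-+ s k (n ∸ k) ⟨
    s * (k + (n ∸ k))                        ≡⟨ cong (s *_) (m+[n∸m]≡n k≤n) ⟩
    s * n                                    ∎

  firsts≡0 : (∑[ a < k ] toℕ a) mod k ≡ zeroMod k
  firsts≡0 = mod≡zeroMod (trans (cong (_% k) ∑-toℕ-k) (m*n%n≡0 s k))

  rowSeconds≡0 : ∀ (i : Fin n) → (∑[ a < k ] toℕ ((multiplier (toℕ a) * toℕ i) mod n)) mod n ≡ zeroMod n
  rowSeconds≡0 i = mod≡zeroMod (begin
    (∑[ a < k ] toℕ ((multiplier (toℕ a) * toℕ i) mod n)) % n  ≡⟨ cong (_% n) (sum-cong-≗ {k} (λ _ → toℕ-mod _)) ⟩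
    (∑[ a < k ] ((multiplier (toℕ a) * toℕ i) % n)) % n        ≡⟨ ∑-% {m = k} (λ a → multiplier (toℕ a) * toℕ i) ⟩
    (∑[ a < k ] (multiplier (toℕ a) * toℕ i)) % n              ≡⟨ cong (_% n) (∑-multiplier-const (toℕ i)) ⟩
    (n * toℕ i) % n                                            ≡⟨ cong (_% n) (*-comm n (toℕ i)) ⟩
    (toℕ i * n) % n                                            ≡⟨ m*n%n≡0 (toℕ i) n ⟩
    0                                                          ∎)

  colSeconds≡0 : ∀ (j : Fin n) →
    (∑[ a < k ] toℕ ((multiplier (toℕ a) * toℕ (diagIndex n (inject≤ a k≤n) j)) mod n)) mod n ≡ zeroMod n
  colSeconds≡0 j = mod≡zeroMod (begin
    (∑[ a < k ] toℕ ((multiplier (toℕ a) * toℕ (diagIndex n (inject≤ a k≤n) j)) mod n)) % n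
      ≡⟨ cong (_% n) (sum-cong-≗ summand) ⟩
    (∑[ a < k ] ((multiplier (toℕ a) * (toℕ j + (n ∸ toℕ a))) % n)) % n
      ≡⟨ ∑-% {m = k} (λ a → multiplier (toℕ a) * (toℕ j + (n ∸ toℕ a))) ⟩
    T % n
      ≡⟨ m+pn≡o+qn⇒m%n≡o%n T s 0 (toℕ j + n) T+sn≡[j+n]n ⟩
    0 % n
      ≡⟨ m*n%n≡0 0 n ⟩
    0 ∎)
    where
    T = ∑[ a < k ] (multiplier (toℕ a) * (toℕ j + (n ∸ toℕ a)))

    summand : ∀ a → toℕ ((multiplier (toℕ a) * toℕ (diagIndex n (inject≤ a k≤n) j)) mod n)
                    ≡ (multiplier (toℕ a) * (toℕ j + (n ∸ toℕ a))) % n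
    summand a = begin
      toℕ ((x * toℕ (diagIndex n (inject≤ a k≤n) j)) mod n)      ≡⟨ toℕ-mod _ ⟩
      (x * toℕ (diagIndex n (inject≤ a k≤n) j)) % n              ≡⟨ cong (λ z → (x * z) % n) (toℕ-mod _) ⟩
      (x * ((toℕ j + (n ∸ toℕ (inject≤ a k≤n))) % n)) % n        ≡⟨ [m*o%n]%n≡[m*o]%n x _ ⟩
      (x * (toℕ j + (n ∸ toℕ (inject≤ a k≤n)))) % n              ≡⟨ cong (λ z → (x * (toℕ j + (n ∸ z))) % n) (toℕ-inject≤ a k≤n) ⟩
      (x * (toℕ j + (n ∸ toℕ a))) % n                            ∎
      where x = multiplier (toℕ a)

    j+[n∸a]+a≡j+n : ∀ (a : Fin k) → toℕ j + (n ∸ toℕ a) + toℕ a ≡ toℕ j + n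
    j+[n∸a]+a≡j+n a = trans (+-assoc (toℕ j) _ (toℕ a))
                            (cong (toℕ j +_) (m∸n+n≡m (≤-trans (<⇒≤ (toℕ<n a)) k≤n)))

    T+sn≡[j+n]n : T + s * n ≡ (toℕ j + n) * n
    T+sn≡[j+n]n = begin
      T + s * n
        ≡⟨ cong (T +_) ∑-multiplier-toℕ ⟨
      T + ∑[ a < k ] (multiplier (toℕ a) * toℕ a)
        ≡⟨ ∑-distrib-+ {k} (λ a → multiplier (toℕ a) * (toℕ j + (n ∸ toℕ a))) (λ a → multiplier (toℕ a) * toℕ a) ⟨
      ∑[ a < k ] (multiplier (toℕ a) * (toℕ j + (n ∸ toℕ a)) + multiplier (toℕ a) * toℕ a)
        ≡⟨ sum-cong-≗ {k} (λ a → trans (sym (*-distribˡ-+ (multiplier (toℕ a)) _ (toℕ a)))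
                                     (cong (multiplier (toℕ a) *_) (j+[n∸a]+a≡j+n a))) ⟩
      ∑[ a < k ] (multiplier (toℕ a) * (toℕ j + n))
        ≡⟨ ∑-multiplier-const (toℕ j + n) ⟩
      n * (toℕ j + n)
        ≡⟨ *-comm n (toℕ j + n) ⟩
      (toℕ j + n) * n ∎

  multiplier-invertible : ∀ d → ∃[ u ] (multiplier d * u) % n ≡ 1 % n
  multiplier-invertible d with d ≡ᵇ s
  ... | false = 1 , refl
  ... | true  = complement-invertible coprime (begin
    suc (n ∸ k) + (k ∸ 1)  ≡⟨ +-suc (n ∸ k) (k ∸ 1) ⟨
    n ∸ k + suc (k ∸ 1)    ≡⟨ cong (n ∸ k +_) (m+[n∸m]≡n (subst (1 ≤_) (sym k≡1+2s) (s≤s z≤n))) ⟩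
    n ∸ k + k              ≡⟨ m∸n+n≡m k≤n ⟩
    n                      ∎)

  inverse : ℕ → ℕ
  inverse d = proj₁ (multiplier-invertible d)

  multiplier*inverse : ∀ d → (multiplier d * inverse d) % n ≡ 1 % n
  multiplier*inverse d = proj₂ (multiplier-invertible d)

  rowOf : Γ k n → Fin n
  rowOf (a , b) = (inverse (toℕ a) * toℕ b) mod n

  cellOf : Γ k n → Fin n × Fin n
  cellOf g = rowOf g , addMod n (rowOf g) (inject≤ (proj₁ g) k≤n)

  array-cellOf : ∀ g → array (proj₁ (cellOf g)) (proj₂ (cellOf g)) ≡ just g
  array-cellOf g@(a , b) = begin
    entry i (diagIndex n i (addMod n i (inject≤ a k≤n)))  ≡⟨ cong (entry i) (diagIndex-addMod i (inject≤ a k≤n)) ⟩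
    entry i (inject≤ a k≤n)                               ≡⟨ entry-inject≤ i a ⟩
    just (a , (multiplier (toℕ a) * toℕ i) mod n)         ≡⟨ cong (λ z → just (a , z)) (toℕ-injective (begin
      toℕ ((multiplier (toℕ a) * toℕ i) mod n)                       ≡⟨ toℕ-mod _ ⟩
      (multiplier (toℕ a) * toℕ i) % n                              ≡⟨ cong (λ z → (multiplier (toℕ a) * z) % n) (toℕ-mod _) ⟩
      (multiplier (toℕ a) * ((inverse (toℕ a) * toℕ b) % n)) % n    ≡⟨ inverse-cancel {x = multiplier (toℕ a)} (multiplier*inverse (toℕ a)) (toℕ b) ⟩
      toℕ b % n                                                     ≡⟨ toℕ%n b ⟩
      toℕ b                                                         ∎)) ⟩
    just (a , b)                                          ∎
    where i = rowOf g

  array≡just⇒cellOf : ∀ i j {g} → array i j ≡ just g → (i , j) ≡ cellOf g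
  array≡just⇒cellOf i j {g@(a , b)} eq = cong₂ _,_ i≡rowOf (begin
    j                                ≡⟨ addMod-diagIndex i j ⟨
    addMod n i (diagIndex n i j)      ≡⟨ cong₂ (addMod n) i≡rowOf d≡a ⟩
    addMod n (rowOf g) (inject≤ a k≤n) ∎)
    where
    d = diagIndex n i j
    toℕd≡a = proj₁ (entry-just i d eq)

    d≡a : d ≡ inject≤ a k≤n
    d≡a = toℕ-injective (trans toℕd≡a (sym (toℕ-inject≤ a k≤n)))

    xi≡b : (multiplier (toℕ a) * toℕ i) % n ≡ toℕ b % n
    xi≡b = begin
      (multiplier (toℕ a) * toℕ i) % n  ≡⟨ cong (λ z → (multiplier z * toℕ i) % n) toℕd≡a ⟨
      (multiplier (toℕ d) * toℕ i) % n  ≡⟨ toℕ-mod _ ⟨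
      toℕ ((multiplier (toℕ d) * toℕ i) mod n) ≡⟨ cong toℕ (proj₂ (entry-just i d eq)) ⟩
      toℕ b                             ≡⟨ toℕ%n b ⟨
      toℕ b % n                         ∎

    i≡rowOf : i ≡ rowOf g
    i≡rowOf = toℕ-injective (begin
      toℕ i                              ≡⟨ toℕ%n i ⟨
      toℕ i % n                          ≡⟨ inverse-solve {x = multiplier (toℕ a)} (multiplier*inverse (toℕ a)) xi≡b ⟩
      (inverse (toℕ a) * toℕ b) % n      ≡⟨ toℕ-mod _ ⟨
      toℕ (rowOf g)                      ∎)

  isM0 : IsM0 k n array
  isM0 = record
    { appearsOnce = λ g → cellOf g , array-cellOf g , λ i j → array≡just⇒cellOf i j
    ; rowCount    = λ i → trans (countFilled-cells (array i)) (trans (∑-row count refl i) ∑1≡k)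
    ; colCount    = λ j → trans (countFilled-cells (λ i → array i j)) (trans (∑-col count refl j) ∑1≡k)
    ; rowSum      = λ i → trans (sumFilledΓ-cells k n (array i))
        (cong₂ _,_ (trans (cong (_mod k) (∑-row first refl i)) firsts≡0)
                   (trans (cong (_mod n) (∑-row second refl i)) (rowSeconds≡0 i)))
    ; colSum      = λ j → trans (sumFilledΓ-cells k n (λ i → array i j))
        (cong₂ _,_ (trans (cong (_mod k) (∑-col first refl j)) firsts≡0)
                   (trans (cong (_mod n) (∑-col second refl j)) (colSeconds≡0 j)))
    }
    where
    count first second : Maybe (Γ k n) → ℕ
    count  = maybe′ (λ _ → 1) 0
    first  = maybe′ (toℕ ∘ proj₁) 0
    second = maybe′ (toℕ ∘ proj₂) 0

    ∑1≡k : ∑[ a < k ] 1 ≡ k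
    ∑1≡k = trans (∑-const k 1) (*-identityʳ k)

  isDiagonal : IsDiagonal n k array
  isDiagonal = zeroMod n , λ i j →
    ⇔-trans (entry-filled i (diagIndex n i j)) (<⇔InDiagRange-zero k≤n (diagIndex n i j))

proposition4p4 : (n k : ℕ) .{{_ : NonZero n}} .{{_ : NonZero k}} →
    3 ≤ k → k ≤ n → n % 2 ≡ 1 → k % 2 ≡ 1 → gcd n (k ∸ 1) ≡ 1 →
    ∃[ M ] (IsM0 k n M × IsDiagonal n k M)
proposition4p4 n k _ k≤n _ k%2≡1 gcd≡1 = array , isM0 , isDiagonal
  where
  s = k / 2
  k≡1+2s : k ≡ suc (s + s)
  k≡1+2s = begin
    k                ≡⟨ m≡m%n+[m/n]*n k 2 ⟩
    k % 2 + s * 2    ≡⟨ cong₂ _+_ k%2≡1 (*-comm s 2) ⟩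
    1 + 2 * s        ≡⟨ cong (λ z → suc (s + z)) (+-identityʳ s) ⟩
    suc (s + s)      ∎
  open DiagonalArray n k s k≡1+2s k≤n (gcd≡1⇒coprime gcd≡1)
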